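{- Let $Q$ be a graph and $d$ a bond of $Q$ such that $Q$ is 3-connected along $d$, and let $L$ and $R$ be the edge sets of the left and right sides of $d$. If both $Q[L]$ and $Q[R]$ consist of a single edge, then $(Q,d)$ is (isomorphic to) the special $K_4$.
   Context: All graphs are simple. For a bond $d$ of a connected graph $Q$, $Q-d$ has two components, the sides of $d$; $L$ and $R$ are their edge sets. For an edge set $Z$, $Q[Z]$ is the subgraph whose edges are $Z$ and whose vertices are the endvertices of edges in $Z$. $Q$ is 3-connected along $d$ if $Q$ is 2-connected and there are no vertices $x$ on the left side and $y$ on the right side with $Q-x-y$ disconnected. The special $K_4$ is $K_4$ together with a bond of size 4 (the four edges between two disjoint pairs of vertices). -}

module Defs where

open import Data.Nat using (ℕ; _≥_)
open import Data.Fin using (Fin; zero; suc; _≟_)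
open import Data.Bool using (Bool; true; false; not; _∧_; _∨_)
open import Data.Product using (Σ; _×_; _,_; ∃; ∃-syntax)
open import Data.Sum using (_⊎_)
open import Relation.Nullary using (¬_; does)
open import Relation.Binary.PropositionalEquality using (_≡_; _≢_)
open import Function.Bundles using (_⇔_; _↔_; Inverse)

record Graph (n : ℕ) : Set where
  field
    adj   : Fin n → Fin n → Bool
    sym   : ∀ u v → adj u v ≡ adj v u
    irref : ∀ u → adj u u ≡ false
open Graph public

EdgeSet : ℕ → Set₁
EdgeSet n = Fin n → Fin n → Set

data Walk {n : ℕ} (E : EdgeSet n) (ok : Fin n → Bool) : Fin n → Fin n → Set where
  here : ∀ {u} → ok u ≡ true → Walk E ok u u
  step : ∀ {u w v} → ok u ≡ true → E u w → Walk E ok w v → Walk E ok u v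

Edges : ∀ {n} → Graph n → EdgeSet n
Edges Q u v = adj Q u v ≡ true

allV : ∀ {n} → Fin n → Bool
allV _ = true

ConnectedOn : ∀ {n} → EdgeSet n → (Fin n → Bool) → Set
ConnectedOn E ok = ∀ u v → ok u ≡ true → ok v ≡ true → Walk E ok u v

Connected : ∀ {n} → Graph n → Set
Connected Q = ConnectedOn (Edges Q) allV

minus2 : ∀ {n} → Fin n → Fin n → Fin n → Bool
minus2 x y w = not (does (w ≟ x) ∨ does (w ≟ y))

TwoConnected : ∀ {n} → Graph n → Set
TwoConnected {n} Q = (n ≥ 3) × Connected Q × (∀ x → ConnectedOn (Edges Q) (minus2 x x))

Cut : ∀ {n} → Graph n → (Fin n → Bool) → EdgeSet n
Cut Q X u v = (adj Q u v ≡ true) × (X u ≢ X v)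

IsCut : ∀ {n} → Graph n → EdgeSet n → Set
IsCut Q d = ∃[ X ] (∀ u v → d u v ⇔ Cut Q X u v)

NonEmpty : ∀ {n} → EdgeSet n → Set
NonEmpty d = ∃[ u ] ∃[ v ] d u v

_⊆E_ : ∀ {n} → EdgeSet n → EdgeSet n → Set
F ⊆E d = ∀ u v → F u v → d u v

-- A bond: a minimal non-empty edge cut (every edge cut is of the form δ(Y)).
IsBond : ∀ {n} → Graph n → EdgeSet n → Set
IsBond Q d = IsCut Q d × NonEmpty d ×
  (∀ (Y : Fin _ → Bool) → NonEmpty (Cut Q Y) → Cut Q Y ⊆E d → d ⊆E Cut Q Y)

Minus : ∀ {n} → Graph n → EdgeSet n → EdgeSet n
Minus Q d u v = (adj Q u v ≡ true) × ¬ d u v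

SameSide : ∀ {n} → Graph n → EdgeSet n → Fin n → Fin n → Set
SameSide Q d u v = Walk (Minus Q d) allV u v

SideEdges : ∀ {n} → Graph n → EdgeSet n → Fin n → EdgeSet n
SideEdges Q d v a b = Minus Q d a b × SameSide Q d v a

SingleEdge : ∀ {n} → EdgeSet n → Set
SingleEdge F = ∃[ u ] ∃[ w ] (u ≢ w × (∀ a b → F a b ⇔ ((a ≡ u × b ≡ w) ⊎ (a ≡ w × b ≡ u))))

ThreeConnAlong : ∀ {n} → Graph n → EdgeSet n → Set
ThreeConnAlong Q d = TwoConnected Q ×
  (∀ x y → ¬ SameSide Q d x y → ConnectedOn (Edges Q) (minus2 x y))

K4 : Graph 4
K4 = record { adj = λ a b → not (does (a ≟ b)) ; sym = s ; irref = i }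
  where
  s : ∀ u v → not (does (u ≟ v)) ≡ not (does (v ≟ u))
  s zero zero = _≡_.refl
  s zero (suc v) = _≡_.refl
  s (suc u) zero = _≡_.refl
  s (suc u) (suc v) with u ≟ v | v ≟ u
  ... | Relation.Nullary.yes _ | Relation.Nullary.yes _ = _≡_.refl
  ... | Relation.Nullary.no _ | Relation.Nullary.no _ = _≡_.refl
  ... | Relation.Nullary.yes p | Relation.Nullary.no q = Data.Empty.⊥-elim (q (Relation.Binary.PropositionalEquality.sym p))
    where import Data.Empty
  ... | Relation.Nullary.no p | Relation.Nullary.yes q = Data.Empty.⊥-elim (p (Relation.Binary.PropositionalEquality.sym q))
    where import Data.Empty
  i : ∀ u → not (does (u ≟ u)) ≡ false
  i u with u ≟ u
  ... | Relation.Nullary.yes _ = _≡_.refl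
  ... | Relation.Nullary.no p = Data.Empty.⊥-elim (p _≡_.refl)
    where import Data.Empty

pairOf : Fin 4 → Bool
pairOf zero = false
pairOf (suc zero) = false
pairOf (suc (suc _)) = true

specialBond : EdgeSet 4
specialBond = Cut K4 pairOf

IsoSpecialK4 : ∀ {n} → Graph n → EdgeSet n → Set
IsoSpecialK4 {n} Q d = Σ (Fin n ↔ Fin 4) λ f →
  let g = Inverse.to f in
  (∀ u v → adj Q u v ≡ adj K4 (g u) (g v)) × (∀ u v → d u v ⇔ specialBond (g u) (g v))

-- Write d = δ(X) and pick an edge pq of d. Each side of d is a single edge, hence has exactly
-- two vertices. Every vertex x lies on the side of p or of q: the two vertices {x, x'} of the
-- side of x are closed under Q - d, so δ({x, x'}) ⊆ d, and minimality of the bond forces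
-- δ({x, x'}) = d, which separates p from q. So Q has exactly four vertices, two on each side.
-- Two vertices on the same side are joined by the side edge; two vertices u, v on different
-- sides are adjacent because Q - u' - v' (removing their partners) is connected and has no
-- other vertices. Hence Q is K4 and d is the cut between the two sides.
module Submission where

open import Defs hiding (sym)
open import Data.Nat using (ℕ)
open import Data.Fin using (Fin; zero; suc; _≟_)
open import Data.Bool using (Bool; true; false; not; _∨_) renaming (_≟_ to _≟ᵇ_)
open import Data.Bool.Properties using (not-injective; not-¬; ¬-not; ∨-zeroʳ)
open import Data.Product using (_×_; _,_; ∃-syntax; proj₁; proj₂)
open import Data.Sum using (_⊎_; inj₁; inj₂; [_,_]′; swap)
open import Data.Empty using (⊥-elim)
open import Relation.Nullary using (¬_; yes; no; does)
open import Relation.Nullary.Decidable using (dec-true; dec-false)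
open import Relation.Binary.PropositionalEquality
  using (_≡_; _≢_; refl; sym; trans; cong; cong₂; subst; subst₂; ≢-sym)
open import Function.Bundles using (_⇔_; _↔_; Inverse; Equivalence; mk⇔; mk↔ₛ′)
open import Function.Construct.Composition using (_⇔-∘_)

two-valued : ∀ {x y : Bool} → x ≢ y → ∀ z → x ≡ z ⊎ y ≡ z
two-valued {x} x≢y z with x ≟ᵇ z
... | yes x≡z = inj₁ x≡z
... | no x≢z = inj₂ (not-injective (trans (sym (¬-not x≢y)) (¬-not x≢z)))

↔-of-injective-surjective : ∀ {a b} {A : Set a} {B : Set b} (h : A → B) →
  (∀ {x y} → h x ≡ h y → x ≡ y) → (∀ y → ∃[ x ] h x ≡ y) → B ↔ A
↔-of-injective-surjective h h-injective h-surjective =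
  mk↔ₛ′ (λ y → proj₁ (h-surjective y)) h
    (λ x → h-injective (proj₂ (h-surjective (h x))))
    (λ y → proj₂ (h-surjective y))

module _ {n} {E : EdgeSet n} {ok : Fin n → Bool} where

  walk-source-ok : ∀ {s t} → Walk E ok s t → ok s ≡ true
  walk-source-ok (here ok-s) = ok-s
  walk-source-ok (step ok-s _ _) = ok-s

  _++ʷ_ : ∀ {s t r} → Walk E ok s t → Walk E ok t r → Walk E ok s r
  here _ ++ʷ w = w
  step ok-s e w ++ʷ w′ = step ok-s e (w ++ʷ w′)

  reverse : (∀ {a b} → E a b → E b a) → ∀ {s t} → Walk E ok s t → Walk E ok t s
  reverse E-sym (here ok-s) = here ok-s
  reverse E-sym (step ok-s e w) = reverse E-sym w ++ʷ step (walk-source-ok w) (E-sym e) (here ok-s)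

  first-step : ∀ {s t} → Walk E ok s t → s ≢ t → ∃[ z ] (E s z × ok z ≡ true)
  first-step (here _) s≢s = ⊥-elim (s≢s refl)
  first-step (step _ e w) _ = _ , e , walk-source-ok w

  crossing-edge : (Y : Fin n → Bool) → ∀ {s t} → Walk E ok s t → Y s ≡ true → Y t ≡ false →
    ∃[ a ] ∃[ b ] (E a b × Y a ≢ Y b)
  crossing-edge Y (here _) Ys Yt = ⊥-elim (not-¬ Ys Yt)
  crossing-edge Y {s} (step {w = w} _ e walk) Ys Yt with Y w in Yw
  ... | true = crossing-edge Y walk Yw Yt
  ... | false = s , w , e , λ Ys≡Yw → not-¬ Ys (trans Ys≡Yw Yw)

adjacent⇒distinct : ∀ {n} (Q : Graph n) {u v} → adj Q u v ≡ true → u ≢ v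
adjacent⇒distinct Q {u} uu refl = not-¬ uu (Graph.irref Q u)

cut-nonempty : ∀ {n} (Q : Graph n) → Connected Q → (Y : Fin n → Bool) → ∀ {s t} →
  Y s ≡ true → Y t ≡ false → NonEmpty (Cut Q Y)
cut-nonempty Q connected Y {s} {t} = crossing-edge Y (connected s t refl refl)

pair : ∀ {n} → Fin n → Fin n → Fin n → Bool
pair u w z = does (z ≟ u) ∨ does (z ≟ w)

pair-intro : ∀ {n} (u w : Fin n) {z} → z ≡ u ⊎ z ≡ w → pair u w z ≡ true
pair-intro u w {z} (inj₁ refl) = cong (_∨ does (z ≟ w)) (dec-true (z ≟ z) refl)
pair-intro u w {z} (inj₂ refl) =
  trans (cong (does (z ≟ u) ∨_) (dec-true (z ≟ z) refl)) (∨-zeroʳ (does (z ≟ u)))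

pair-elim : ∀ {n} (u w z : Fin n) → pair u w z ≡ true → z ≡ u ⊎ z ≡ w
pair-elim u w z z∈ with z ≟ u | z ≟ w
pair-elim u w z _  | yes z≡u | _       = inj₁ z≡u
pair-elim u w z _  | no _    | yes z≡w = inj₂ z≡w
pair-elim u w z () | no _    | no _

minus2-true⇒ : ∀ {n} {x y z : Fin n} → minus2 x y z ≡ true → z ≢ x × z ≢ y
minus2-true⇒ {x = x} {y} {z} z-ok with z ≟ x | z ≟ y
minus2-true⇒ () | yes _ | _
minus2-true⇒ () | no _ | yes _
minus2-true⇒ _  | no z≢x | no z≢y = z≢x , z≢y

minus2-true : ∀ {n} {x y z : Fin n} → z ≢ x → z ≢ y → minus2 x y z ≡ true
minus2-true {x = x} {y} {z} z≢x z≢y =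
  cong not (cong₂ _∨_ (dec-false (z ≟ x) z≢x) (dec-false (z ≟ y) z≢y))

Complete : ∀ {n} → Graph n → Set
Complete Q = ∀ u v → u ≢ v → adj Q u v ≡ true

adj-complete : ∀ {m n} (Q : Graph n) → Complete Q → (h : Fin m → Fin n) →
  (∀ {i j} → h i ≡ h j → i ≡ j) → ∀ i j → adj Q (h i) (h j) ≡ not (does (i ≟ j))
adj-complete Q complete h h-injective i j with i ≟ j
... | yes refl = Graph.irref Q (h i)
... | no i≢j = complete (h i) (h j) (λ hi≡hj → i≢j (h-injective hi≡hj))

cut-pullback : ∀ {m n} (Q′ : Graph m) (Q : Graph n) (h : Fin m → Fin n)
  {X : Fin n → Bool} {Y : Fin m → Bool} →
  (∀ i j → adj Q (h i) (h j) ≡ adj Q′ i j) → (∀ i j → X (h i) ≡ X (h j) ⇔ Y i ≡ Y j) →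
  ∀ i j → Cut Q X (h i) (h j) ⇔ Cut Q′ Y i j
cut-pullback Q′ Q h adj-h X⇔Y i j = mk⇔
  (λ (a , X≢) → trans (sym (adj-h i j)) a , λ Y≡ → X≢ (Equivalence.from (X⇔Y i j) Y≡))
  (λ (a , Y≢) → trans (adj-h i j) a , λ X≡ → Y≢ (Equivalence.to (X⇔Y i j) X≡))

isoSpecialK4-of-enumeration : ∀ {n} (Q : Graph n) (d : EdgeSet n) (h : Fin 4 → Fin n) →
  (∀ {i j} → h i ≡ h j → i ≡ j) → (∀ z → ∃[ i ] h i ≡ z) →
  (∀ i j → adj Q (h i) (h j) ≡ adj K4 i j) → (∀ i j → d (h i) (h j) ⇔ specialBond i j) →
  IsoSpecialK4 Q d
isoSpecialK4-of-enumeration Q d h h-injective h-surjective adj-h d-h = f , adj-g , d-g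
  where
  f : _ ↔ Fin 4
  f = ↔-of-injective-surjective h h-injective h-surjective

  g : _ → Fin 4
  g = Inverse.to f

  h∘g : ∀ u → h (g u) ≡ u
  h∘g u = proj₂ (h-surjective u)

  adj-g : ∀ u v → adj Q u v ≡ adj K4 (g u) (g v)
  adj-g u v = trans (cong₂ (adj Q) (sym (h∘g u)) (sym (h∘g v))) (adj-h (g u) (g v))

  d-g : ∀ u v → d u v ⇔ specialBond (g u) (g v)
  d-g u v = subst₂ (λ a b → d a b ⇔ specialBond (g u) (g v)) (h∘g u) (h∘g v) (d-h (g u) (g v))

module OnCut {n} (Q : Graph n) (d : EdgeSet n) (X : Fin n → Bool)
  (d⇔cut : ∀ u v → d u v ⇔ Cut Q X u v) where

  d⇒cut : ∀ {u v} → d u v → Cut Q X u v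
  d⇒cut = Equivalence.to (d⇔cut _ _)

  cut⇒d : ∀ {u v} → Cut Q X u v → d u v
  cut⇒d = Equivalence.from (d⇔cut _ _)

  adj-sym : ∀ {u v} → adj Q u v ≡ true → adj Q v u ≡ true
  adj-sym {u} {v} = trans (Graph.sym Q v u)

  d-sym : ∀ {u v} → d u v → d v u
  d-sym duv with d⇒cut duv
  ... | a , Xu≢Xv = cut⇒d (adj-sym a , ≢-sym Xu≢Xv)

  minus-sym : ∀ {u v} → Minus Q d u v → Minus Q d v u
  minus-sym (a , ¬duv) = adj-sym a , λ dvu → ¬duv (d-sym dvu)

  minus⇒X≡ : ∀ {u v} → Minus Q d u v → X u ≡ X v
  minus⇒X≡ {u} {v} (a , ¬duv) with X u ≟ᵇ X v
  ... | yes Xu≡Xv = Xu≡Xv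
  ... | no Xu≢Xv = ⊥-elim (¬duv (cut⇒d (a , Xu≢Xv)))

  sameSide⇒X≡ : ∀ {u v} → SameSide Q d u v → X u ≡ X v
  sameSide⇒X≡ (here _) = refl
  sameSide⇒X≡ (step _ e w) = trans (minus⇒X≡ e) (sameSide⇒X≡ w)

  sameSide-sym : ∀ {u v} → SameSide Q d u v → SameSide Q d v u
  sameSide-sym = reverse minus-sym

  sameSide-edge : ∀ {u v} → Minus Q d u v → SameSide Q d u v
  sameSide-edge e = step refl e (here refl)

  ClosedUnderMinus : (Fin n → Bool) → Set
  ClosedUnderMinus Y = ∀ {s t} → Minus Q d s t → Y s ≡ true → Y t ≡ true

  closed⇒constant-on-edges : ∀ {Y} → ClosedUnderMinus Y → ∀ {s t} → Minus Q d s t → Y s ≡ Y t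
  closed⇒constant-on-edges {Y} closed {s} {t} st with Y s in Ys | Y t in Yt
  ... | true  | true  = refl
  ... | false | false = refl
  ... | true  | false = trans (sym (closed st Ys)) Yt
  ... | false | true  = trans (sym Ys) (closed (minus-sym st) Yt)

  closed⇒cut⊆ : ∀ {Y} → ClosedUnderMinus Y → Cut Q Y ⊆E d
  closed⇒cut⊆ closed s t (a , Ys≢Yt) with X s ≟ᵇ X t
  ... | yes Xs≡Xt = ⊥-elim (Ys≢Yt (closed⇒constant-on-edges closed (a , λ dst → proj₂ (d⇒cut dst) Xs≡Xt)))
  ... | no Xs≢Xt = cut⇒d (a , Xs≢Xt)

  closed-set-meets-bond-edge : Connected Q →
    (∀ Y → NonEmpty (Cut Q Y) → Cut Q Y ⊆E d → d ⊆E Cut Q Y) →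
    ∀ {Y} → ClosedUnderMinus Y → ∀ {x p q} → Y x ≡ true → Y p ≡ false → d p q → Y q ≡ true
  closed-set-meets-bond-edge connected minimal {Y} closed {p = p} {q} Yx Yp pq =
    trans (¬-not (≢-sym Yp≢Yq)) (cong not Yp)
    where
    Yp≢Yq : Y p ≢ Y q
    Yp≢Yq = proj₂ (minimal Y (cut-nonempty Q connected Y Yx Yp) (closed⇒cut⊆ closed) _ _ pq)

  record SideIsEdge (v w : Fin n) : Set where
    field
      distinct : v ≢ w
      edge     : Minus Q d v w
      vertices : ∀ z → SameSide Q d v z → z ≡ v ⊎ z ≡ w

  module _ {v u w : Fin n}
    (side⇔uw : ∀ a b → SideEdges Q d v a b ⇔ ((a ≡ u × b ≡ w) ⊎ (a ≡ w × b ≡ u))) where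

    side-edge : SideEdges Q d v u w
    side-edge = Equivalence.from (side⇔uw u w) (inj₁ (refl , refl))

    -- A vertex z ≠ u of the side has a Q - d edge on the way to u, which must be uw or wu.
    single-edge-endpoints : ∀ z → SameSide Q d v z → z ≡ u ⊎ z ≡ w
    single-edge-endpoints z vz with z ≟ u
    ... | yes z≡u = inj₁ z≡u
    ... | no z≢u with first-step (sameSide-sym vz ++ʷ proj₂ side-edge) z≢u
    ... | y , zy , _ = [ (λ (z≡u , _) → inj₁ z≡u) , (λ (z≡w , _) → inj₂ z≡w) ]′
                          (Equivalence.to (side⇔uw z y) (zy , vz))

  singleEdge⇒sideIsEdge : ∀ v → SingleEdge (SideEdges Q d v) → ∃[ w ] SideIsEdge v w
  singleEdge⇒sideIsEdge v (u , w , u≢w , side⇔uw) with single-edge-endpoints side⇔uw v (here refl)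
  ... | inj₁ refl = w , record
    { distinct = u≢w
    ; edge     = proj₁ (side-edge side⇔uw)
    ; vertices = single-edge-endpoints side⇔uw
    }
  ... | inj₂ refl = u , record
    { distinct = ≢-sym u≢w
    ; edge     = minus-sym (proj₁ (side-edge side⇔uw))
    ; vertices = λ z vz → swap (single-edge-endpoints side⇔uw z vz)
    }

module SpecialK4 {n} (Q : Graph n) (d : EdgeSet n) (bond : IsBond Q d) (tc : ThreeConnAlong Q d)
  (single : ∀ v → SingleEdge (SideEdges Q d v)) where

  X : Fin n → Bool
  X = proj₁ (proj₁ bond)

  d⇔cut : ∀ u v → d u v ⇔ Cut Q X u v
  d⇔cut = proj₂ (proj₁ bond)

  open OnCut Q d X d⇔cut
  open SideIsEdge

  p q : Fin n
  p = proj₁ (proj₁ (proj₂ bond))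
  q = proj₁ (proj₂ (proj₁ (proj₂ bond)))

  pq : d p q
  pq = proj₂ (proj₂ (proj₁ (proj₂ bond)))

  Xp≢Xq : X p ≢ X q
  Xp≢Xq = proj₂ (d⇒cut pq)

  partner : Fin n → Fin n
  partner v = proj₁ (singleEdge⇒sideIsEdge v (single v))

  sideIsEdge : ∀ v → SideIsEdge v (partner v)
  sideIsEdge v = proj₂ (singleEdge⇒sideIsEdge v (single v))

  X-partner : ∀ v → X (partner v) ≡ X v
  X-partner v = sym (minus⇒X≡ (edge (sideIsEdge v)))

  sideVertices : Fin n → Fin n → Bool
  sideVertices x = pair x (partner x)

  sideVertices⇒sameSide : ∀ {x z} → sideVertices x z ≡ true → SameSide Q d x z
  sideVertices⇒sameSide {x} {z} x∼z with pair-elim x (partner x) z x∼z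
  ... | inj₁ refl = here refl
  ... | inj₂ refl = sameSide-edge (edge (sideIsEdge x))

  sideVertices-closed : ∀ x → ClosedUnderMinus (sideVertices x)
  sideVertices-closed x st x∼s =
    pair-intro x (partner x) (vertices (sideIsEdge x) _ (sideVertices⇒sameSide x∼s ++ʷ sameSide-edge st))

  on-side-of-p-or-q : ∀ x → SameSide Q d p x ⊎ SameSide Q d q x
  on-side-of-p-or-q x with sideVertices x p in x∼p
  ... | true  = inj₁ (sameSide-sym (sideVertices⇒sameSide x∼p))
  ... | false = inj₂ (sameSide-sym (sideVertices⇒sameSide
    (closed-set-meets-bond-edge (proj₁ (proj₂ (proj₁ tc))) (proj₂ (proj₂ bond))
      (sideVertices-closed x) {x = x} (pair-intro x (partner x) (inj₁ refl)) x∼p pq)))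

  X≡⇒sameSide : ∀ {u v} → X u ≡ X v → SameSide Q d u v
  X≡⇒sameSide {u} {v} Xu≡Xv with on-side-of-p-or-q u | on-side-of-p-or-q v
  ... | inj₁ pu | inj₁ pv = sameSide-sym pu ++ʷ pv
  ... | inj₂ qu | inj₂ qv = sameSide-sym qu ++ʷ qv
  ... | inj₁ pu | inj₂ qv =
    ⊥-elim (Xp≢Xq (trans (sameSide⇒X≡ pu) (trans Xu≡Xv (sym (sameSide⇒X≡ qv)))))
  ... | inj₂ qu | inj₁ pv =
    ⊥-elim (Xp≢Xq (trans (sameSide⇒X≡ pv) (trans (sym Xu≡Xv) (sym (sameSide⇒X≡ qu)))))

  X≡⇒partner : ∀ {u z} → X u ≡ X z → z ≡ u ⊎ z ≡ partner u
  X≡⇒partner {u} {z} Xu≡Xz = vertices (sideIsEdge u) z (X≡⇒sameSide Xu≡Xz)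

  adjacent-within : ∀ {u v} → X u ≡ X v → u ≢ v → adj Q u v ≡ true
  adjacent-within Xu≡Xv u≢v with X≡⇒partner Xu≡Xv
  ... | inj₁ refl = ⊥-elim (u≢v refl)
  ... | inj₂ refl = proj₁ (edge (sideIsEdge _))

  ≢partner : ∀ {u v} → X u ≢ X v → u ≢ partner v
  ≢partner {v = v} Xu≢Xv u≡v′ = Xu≢Xv (trans (cong X u≡v′) (X-partner v))

  partners-apart : ∀ {u v} → X u ≢ X v → ¬ SameSide Q d (partner u) (partner v)
  partners-apart {u} {v} Xu≢Xv u′v′ =
    Xu≢Xv (trans (sym (X-partner u)) (trans (sameSide⇒X≡ u′v′) (X-partner v)))

  -- Q - partner u - partner v has no vertices besides u and v.
  only-neighbour : ∀ {u v z} → X u ≢ X v → adj Q u z ≡ true →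
    minus2 (partner u) (partner v) z ≡ true → z ≡ v
  only-neighbour {u} {v} {z} Xu≢Xv uz z-ok with minus2-true⇒ z-ok | two-valued Xu≢Xv (X z)
  ... | z≢u′ , _ | inj₁ Xu≡Xz =
    [ (λ z≡u → ⊥-elim (adjacent⇒distinct Q uz (sym z≡u))) , (λ z≡u′ → ⊥-elim (z≢u′ z≡u′)) ]′
      (X≡⇒partner Xu≡Xz)
  ... | _ , z≢v′ | inj₂ Xv≡Xz =
    [ (λ z≡v → z≡v) , (λ z≡v′ → ⊥-elim (z≢v′ z≡v′)) ]′ (X≡⇒partner Xv≡Xz)

  adjacent-across : ∀ {u v} → X u ≢ X v → adj Q u v ≡ true
  adjacent-across {u} {v} Xu≢Xv
    with first-step (proj₂ tc (partner u) (partner v) (partners-apart Xu≢Xv) u v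
                       (minus2-true (distinct (sideIsEdge u)) (≢partner Xu≢Xv))
                       (minus2-true (≢partner (≢-sym Xu≢Xv)) (distinct (sideIsEdge v))))
                    (λ u≡v → Xu≢Xv (cong X u≡v))
  ... | z , uz , z-ok = subst (λ z → adj Q u z ≡ true) (only-neighbour Xu≢Xv uz z-ok) uz

  complete : Complete Q
  complete u v u≢v with X u ≟ᵇ X v
  ... | yes Xu≡Xv = adjacent-within Xu≡Xv u≢v
  ... | no Xu≢Xv = adjacent-across Xu≢Xv

  vertex : Fin 4 → Fin n
  vertex zero                   = p
  vertex (suc zero)             = partner p
  vertex (suc (suc zero))       = q
  vertex (suc (suc (suc zero))) = partner q

  shore : Bool → Bool
  shore false = X p
  shore true  = X q

  shore-injective : ∀ {b c} → shore b ≡ shore c → b ≡ c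
  shore-injective {false} {false} _ = refl
  shore-injective {true}  {true}  _ = refl
  shore-injective {false} {true}  Xp≡Xq = ⊥-elim (Xp≢Xq Xp≡Xq)
  shore-injective {true}  {false} Xq≡Xp = ⊥-elim (Xp≢Xq (sym Xq≡Xp))

  X-vertex : ∀ i → X (vertex i) ≡ shore (pairOf i)
  X-vertex zero                   = refl
  X-vertex (suc zero)             = X-partner p
  X-vertex (suc (suc zero))       = refl
  X-vertex (suc (suc (suc zero))) = X-partner q

  X-vertex⇔ : ∀ i j → X (vertex i) ≡ X (vertex j) ⇔ pairOf i ≡ pairOf j
  X-vertex⇔ i j = mk⇔
    (λ X≡ → shore-injective (trans (sym (X-vertex i)) (trans X≡ (X-vertex j))))
    (λ pair≡ → trans (X-vertex i) (trans (cong shore pair≡) (sym (X-vertex j))))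

  same-pair : ∀ i j → vertex i ≡ vertex j → pairOf i ≡ pairOf j
  same-pair i j e = Equivalence.to (X-vertex⇔ i j) (cong X e)

  vertex-injective : ∀ {i j} → vertex i ≡ vertex j → i ≡ j
  vertex-injective {zero}                 {zero}                 _ = refl
  vertex-injective {suc zero}             {suc zero}             _ = refl
  vertex-injective {suc (suc zero)}       {suc (suc zero)}       _ = refl
  vertex-injective {suc (suc (suc zero))} {suc (suc (suc zero))} _ = refl
  vertex-injective {zero}                 {suc zero}             e = ⊥-elim (distinct (sideIsEdge p) e)
  vertex-injective {suc zero}             {zero}                 e = ⊥-elim (distinct (sideIsEdge p) (sym e))
  vertex-injective {suc (suc zero)}       {suc (suc (suc zero))} e = ⊥-elim (distinct (sideIsEdge q) e)
  vertex-injective {suc (suc (suc zero))} {suc (suc zero)}       e = ⊥-elim (distinct (sideIsEdge q) (sym e))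
  vertex-injective {zero}        {suc (suc j)} e with same-pair zero (suc (suc j)) e
  ... | ()
  vertex-injective {suc zero}    {suc (suc j)} e with same-pair (suc zero) (suc (suc j)) e
  ... | ()
  vertex-injective {suc (suc i)} {zero}        e with same-pair (suc (suc i)) zero e
  ... | ()
  vertex-injective {suc (suc i)} {suc zero}    e with same-pair (suc (suc i)) (suc zero) e
  ... | ()

  vertex-surjective : ∀ z → ∃[ i ] vertex i ≡ z
  vertex-surjective z with two-valued Xp≢Xq (X z)
  ... | inj₁ Xp≡Xz = [ (λ z≡p → zero , sym z≡p) , (λ z≡p′ → suc zero , sym z≡p′) ]′ (X≡⇒partner Xp≡Xz)
  ... | inj₂ Xq≡Xz = [ (λ z≡q → suc (suc zero) , sym z≡q) , (λ z≡q′ → suc (suc (suc zero)) , sym z≡q′) ]′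
                       (X≡⇒partner Xq≡Xz)

  adj-vertex : ∀ i j → adj Q (vertex i) (vertex j) ≡ adj K4 i j
  adj-vertex = adj-complete Q complete vertex vertex-injective

  d-vertex : ∀ i j → d (vertex i) (vertex j) ⇔ specialBond i j
  d-vertex i j = cut-pullback K4 Q vertex {X} {pairOf} adj-vertex X-vertex⇔ i j ⇔-∘ d⇔cut (vertex i) (vertex j)

lemma4p6 : (n : ℕ) (Q : Graph n) (d : EdgeSet n) →
    IsBond Q d → ThreeConnAlong Q d →
    (∀ v → SingleEdge (SideEdges Q d v)) →
    IsoSpecialK4 Q d
lemma4p6 n Q d bond tc single =
  isoSpecialK4-of-enumeration Q d vertex vertex-injective vertex-surjective adj-vertex d-vertex
  where open SpecialK4 Q d bond tc single
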